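{- Let $A$ be a finite set of alternatives and let $\mathcal{D}\subseteq\mathcal{L}(A)$ be a semi-connected Condorcet domain of maximal width. Then: (i) for any $a\in A$, the restriction $\mathcal{D}'=\mathcal{D}_{A\setminus\{a\}}$ of $\mathcal{D}$ to $A'=A\setminus\{a\}$ is also a semi-connected domain of maximal width; (ii) $\mathcal{D}$ is a copious peak-pit domain.
   Context: $\mathcal{L}(A)$ denotes the set of strict linear orders on the finite set $A$; a linear order $a_1>a_2>\dots>a_n$ is written as the string $a_1a_2\dots a_n$, and its reversal (flip) $a_na_{n-1}\dots a_1$ is written $\bar{x}$ if $x=a_1\dots a_n$. A domain is a subset $\mathcal{D}\subseteq\mathcal{L}(A)$. For $B\subseteq A$, $\mathcal{D}_B$ denotes the set of restrictions to $B$ of the orders in $\mathcal{D}$. A profile over $\mathcal{D}$ is a finite sequence of (not necessarily distinct) orders from $\mathcal{D}$; its majority relation puts $a$ above $b$ if strictly more orders of the profile rank $a$ above $b$ than $b$ above $a$. $\mathcal{D}$ is a Condorcet domain if for every profile over $\mathcal{D}$ with an odd number of orders, the majority relation is transitive. For distinct $a,b,c\in A$, $x\in\{a,b,c\}$ and $i\in\{1,2,3\}$, a domain satisfies the never condition $xN_{\{a,b,c\}}i$ if in no order of the domain is $x$ ranked in position $i$ among $a,b,c$ (position 1 = top, 3 = bottom). A peak-pit domain is a domain such that for every triple of distinct alternatives $\{a,b,c\}$ it satisfies some condition $xN_{\{a,b,c\}}1$ or some condition $xN_{\{a,b,c\}}3$ with $x\in\{a,b,c\}$. A Condorcet domain is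 copious if for every triple of distinct alternatives $a,b,c$ the restriction $\mathcal{D}_{\{a,b,c\}}$ consists of exactly four distinct orders. $\mathcal{D}$ has maximal width if it contains some order $w$ together with its reversal $\bar w$. A domain of maximal width is semi-connected if there are completely reversed orders $w,\bar w\in\mathcal{D}$ and a sequence of orders $w=w_0,w_1,\dots,w_N=\bar w$ in $\mathcal{D}$, $N=\binom{|A|}{2}$, in which each $w_{k+1}$ is obtained from $w_k$ by swapping two alternatives adjacent in $w_k$ (so each pair of alternatives is swapped exactly once; i.e. a maximal chain of the Bruhat order from $w$ to $\bar w$ lying in $\mathcal{D}$). -}

module Defs where

open import Data.Nat using (ℕ; zero; suc; _+_; _*_; _<_; _≟_)
open import Data.Nat.Combinatorics using (_C_)
open import Data.Bool using (Bool; true; false; if_then_else_)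
open import Data.List using (List; []; _∷_; _++_; [_]; length; filter; reverse)
open import Data.List.Relation.Unary.All using (All)
open import Data.List.Relation.Unary.Unique.Propositional using (Unique)
open import Data.List.Relation.Binary.Permutation.Propositional using (_↭_)
open import Data.List.Membership.Propositional using (_∈_)
open import Data.List.Membership.DecPropositional _≟_ using (_∈?_)
open import Data.Product using (Σ; ∃; ∃-syntax; _×_; _,_)
open import Data.Sum using (_⊎_)
open import Relation.Nullary using (¬_; does; yes; no; ¬?)
open import Relation.Binary.PropositionalEquality using (_≡_; _≢_)

-- Alternatives are natural numbers; a finite set of alternatives A is a
-- duplicate-free list of naturals.  A linear order a1 > a2 > ... > an is the
-- list a1 ∷ a2 ∷ ... ∷ an (best first); it is a linear order on A iff it is a
-- permutation of A.

Order : Set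
Order = List ℕ

LinOrderOn : List ℕ → Order → Set
LinOrderOn A x = x ↭ A

Pred : Set₁
Pred = Order → Set

IsDomain : List ℕ → Pred → Set
IsDomain A D = ∀ x → D x → LinOrderOn A x

restrict : List ℕ → Order → Order
restrict B x = filter (λ c → c ∈? B) x

Restr : Pred → List ℕ → Pred
Restr D B y = ∃[ x ] (D x × restrict B x ≡ y)

above : Order → ℕ → ℕ → Bool
above [] a b = false
above (c ∷ x) a b with c ≟ a
... | yes _ = does (b ∈? x)
... | no _ with c ≟ b
...   | yes _ = false
...   | no _ = above x a b

count : List Order → ℕ → ℕ → ℕ
count [] a b = 0
count (x ∷ P) a b = (if above x a b then 1 else 0) + count P a b

Maj : List Order → ℕ → ℕ → Set
Maj P a b = count P b a < count P a b

Odd : ℕ → Set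
Odd n = ∃[ k ] (n ≡ suc (2 * k))

Condorcet : Pred → Set
Condorcet D = ∀ (P : List Order) → All D P → Odd (length P) →
  ∀ a b c → Maj P a b → Maj P b c → Maj P a c

DistinctTriple : List ℕ → ℕ → ℕ → ℕ → Set
DistinctTriple A a b c = a ∈ A × b ∈ A × c ∈ A × a ≢ b × b ≢ c × a ≢ c

-- x occupies position i (1 = top) in the list l
AtPos : Order → ℕ → ℕ → Set
AtPos l x i = ∃[ pre ] ∃[ suf ] (l ≡ pre ++ x ∷ suf × suc (length pre) ≡ i)

-- never condition  x N_{a,b,c} i  (positions among a,b,c; 1 = top, 3 = bottom)
Never : Pred → ℕ → ℕ → ℕ → ℕ → ℕ → Set
Never D a b c x i = ∀ v → D v → ¬ AtPos (restrict (a ∷ b ∷ c ∷ []) v) x i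

PeakPit : List ℕ → Pred → Set
PeakPit A D = ∀ a b c → DistinctTriple A a b c →
  ∃[ x ] ((x ≡ a ⊎ x ≡ b ⊎ x ≡ c) × (Never D a b c x 1 ⊎ Never D a b c x 3))

ExactlyFour : Pred → Set
ExactlyFour P = ∃[ L ] (length L ≡ 4 × Unique L × (∀ y → (P y → y ∈ L) × (y ∈ L → P y)))

Copious : List ℕ → Pred → Set
Copious A D = Condorcet D × (∀ a b c → DistinctTriple A a b c →
  ExactlyFour (Restr D (a ∷ b ∷ c ∷ [])))

MaximalWidth : Pred → Set
MaximalWidth D = ∃[ w ] (D w × D (reverse w))

AdjSwap : Order → Order → Set
AdjSwap x y = ∃[ p ] ∃[ a ] ∃[ b ] ∃[ s ] (x ≡ p ++ a ∷ b ∷ s × y ≡ p ++ b ∷ a ∷ s)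

data Chain (D : Pred) : ℕ → Order → Order → Set where
  done : ∀ {x} → D x → Chain D 0 x x
  step : ∀ {n x y z} → D x → AdjSwap x y → Chain D n y z → Chain D (suc n) x z

SemiConnected : List ℕ → Pred → Set
SemiConnected A D =
  ∃[ w ] (D w × D (reverse w) × Chain D (length A C 2) w (reverse w))

remove : ℕ → List ℕ → List ℕ
remove a A = filter (λ c → ¬? (c ≟ a)) A

-- For an order w, count the inversions of an order x relative to w: the pairs that x ranks
-- opposite to w.  An adjacent swap changes this count by at most one, and it grows from 0 at w
-- to n(n-1)/2 at the reverse of w, so along a maximal chain every swap reverses a pair that is
-- still in w's order.  Restricted to a subset B of the alternatives, the swaps of pairs inside B
-- stay adjacent swaps and all others become trivial; hence the restriction is again a maximal
-- chain, which gives (i).  For a triple, the restricted chain from p q r to r q p passes through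
-- q p r, q r p or through p r q, r p q.  Orders s t v, t v s and v s t would produce the majority
-- cycle s > t > v > s, so the Condorcet property excludes the remaining two orders: exactly four
-- orders remain, and q is never last, respectively never first.

module Submission where

open import Defs
open import Data.Nat using (ℕ; suc; _+_; _≤_; _<_; z≤n; s≤s; _≟_)
open import Data.Bool using (Bool; true; false; if_then_else_)
open import Data.Empty using (⊥-elim)
open import Data.List using (List; []; _∷_; _++_; [_]; length; reverse)
open import Data.List.Properties
  using (filter-++; filter-accept; filter-reject; unfold-reverse; length-reverse; ++-identityʳ; ∷-injective)
open import Data.List.Membership.Propositional using (_∈_; _∉_)
open import Data.List.Membership.Propositional.Properties using (∈-filter⁺; ∈-filter⁻)
open import Data.List.Membership.Propositional.Properties.WithK using (unique∧set⇒bag)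
open import Data.List.Membership.DecPropositional _≟_ using (_∈?_)
open import Data.List.Relation.Binary.BagAndSetEquality using (∼bag⇒↭)
open import Data.List.Relation.Binary.Permutation.Propositional using (_↭_; ↭-sym; ↭-trans; ↭⇒↭ₛ)
open import Data.List.Relation.Binary.Permutation.Propositional.Properties using (↭-length; ∈-resp-↭)
import Data.List.Relation.Binary.Permutation.Setoid.Properties as Permutationₛ
open import Data.List.Relation.Binary.Subset.Propositional using (_⊆_)
open import Data.List.Relation.Unary.All as All using (All; []; _∷_)
open import Data.List.Relation.Unary.AllPairs using ([]; _∷_)
open import Data.List.Relation.Unary.Any using (here; there)
open import Data.List.Relation.Unary.Any.Properties using (reverse⁻)
open import Data.List.Relation.Unary.Unique.Propositional using (Unique)
import Data.List.Relation.Unary.Unique.Propositional.Properties as Unique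
open import Data.Nat.Combinatorics using (_C_; nC1≡n; nCk+nC[k+1]≡[n+1]C[k+1])
open import Data.Nat.Properties
open import Data.Nat.Tactic.RingSolver using (solve-∀)
open import Data.Product using (∃-syntax; _×_; _,_; proj₁; proj₂; map₂)
open import Data.Sum as Sum using (_⊎_; inj₁; inj₂)
open import Function using (_∘_)
open import Function.Bundles using (mk⇔)
open import Relation.Binary.PropositionalEquality hiding ([_])
open import Relation.Nullary using (¬_; ¬?; Dec; yes; no; does)
open import Relation.Nullary.Decidable using (dec-true)

Unique-resp-↭ : ∀ {x y : List ℕ} → x ↭ y → Unique x → Unique y
Unique-resp-↭ x↭y = Permutationₛ.Unique-resp-↭ (setoid ℕ) (↭⇒↭ₛ x↭y)

-- Inversion counts

indicator : Bool → ℕ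
indicator u = if u then 1 else 0

inversionsAfter : (ℕ → ℕ → Bool) → ℕ → List ℕ → ℕ
inversionsAfter R c [] = 0
inversionsAfter R c (d ∷ x) = indicator (R d c) + inversionsAfter R c x

inversionsBefore : (ℕ → ℕ → Bool) → ℕ → List ℕ → ℕ
inversionsBefore R c [] = 0
inversionsBefore R c (d ∷ x) = indicator (R c d) + inversionsBefore R c x

inversions : (ℕ → ℕ → Bool) → List ℕ → ℕ
inversions R [] = 0
inversions R (c ∷ x) = inversionsAfter R c x + inversions R x

inversionsAfter-swap : ∀ R c p a b s →
  inversionsAfter R c (p ++ a ∷ b ∷ s) ≡ inversionsAfter R c (p ++ b ∷ a ∷ s)
inversionsAfter-swap R c [] a b s =
  +-exchange (indicator (R a c)) (indicator (R b c)) (inversionsAfter R c s)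
  where
  +-exchange : ∀ x y z → x + (y + z) ≡ y + (x + z)
  +-exchange = solve-∀
inversionsAfter-swap R c (d ∷ p) a b s = cong (indicator (R d c) +_) (inversionsAfter-swap R c p a b s)

inversions-swap : ∀ R p a b s →
  inversions R (p ++ a ∷ b ∷ s) + indicator (R a b) ≡ inversions R (p ++ b ∷ a ∷ s) + indicator (R b a)
inversions-swap R [] a b s =
  rearrange (indicator (R b a)) (indicator (R a b)) (inversionsAfter R a s) (inversionsAfter R b s) (inversions R s)
  where
  rearrange : ∀ x y u v w → (x + u) + (v + w) + y ≡ (y + v) + (u + w) + x
  rearrange = solve-∀
inversions-swap R (c ∷ p) a b s = begin
  inversionsAfter R c (p ++ a ∷ b ∷ s) + inversions R (p ++ a ∷ b ∷ s) + indicator (R a b)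
    ≡⟨ +-assoc (inversionsAfter R c (p ++ a ∷ b ∷ s)) _ _ ⟩
  inversionsAfter R c (p ++ a ∷ b ∷ s) + (inversions R (p ++ a ∷ b ∷ s) + indicator (R a b))
    ≡⟨ cong₂ _+_ (inversionsAfter-swap R c p a b s) (inversions-swap R p a b s) ⟩
  inversionsAfter R c (p ++ b ∷ a ∷ s) + (inversions R (p ++ b ∷ a ∷ s) + indicator (R b a))
    ≡⟨ +-assoc (inversionsAfter R c (p ++ b ∷ a ∷ s)) _ _ ⟨
  inversionsAfter R c (p ++ b ∷ a ∷ s) + inversions R (p ++ b ∷ a ∷ s) + indicator (R b a) ∎
  where open ≡-Reasoning

indicator≤1 : ∀ u → indicator u ≤ 1
indicator≤1 true = ≤-refl
indicator≤1 false = z≤n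

inversions-swap-≤ : ∀ R p a b s → inversions R (p ++ b ∷ a ∷ s) ≤ inversions R (p ++ a ∷ b ∷ s) + 1
inversions-swap-≤ R p a b s = begin
  inversions R (p ++ b ∷ a ∷ s)                            ≤⟨ m≤m+n _ (indicator (R b a)) ⟩
  inversions R (p ++ b ∷ a ∷ s) + indicator (R b a)        ≡⟨ inversions-swap R p a b s ⟨
  inversions R (p ++ a ∷ b ∷ s) + indicator (R a b)        ≤⟨ +-monoʳ-≤ _ (indicator≤1 (R a b)) ⟩
  inversions R (p ++ a ∷ b ∷ s) + 1                        ∎
  where open ≤-Reasoning

inversions-chain-≤ : ∀ R {D N x z} → Chain D N x z → inversions R z ≤ inversions R x + N
inversions-chain-≤ R {x = x} (done _) = m≤m+n (inversions R x) 0
inversions-chain-≤ R {N = suc N} {x} {z} (step {y = y} _ (p , a , b , s , refl , refl) ch) = begin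
  inversions R z              ≤⟨ inversions-chain-≤ R ch ⟩
  inversions R y + N          ≤⟨ +-monoˡ-≤ N (inversions-swap-≤ R p a b s) ⟩
  inversions R x + 1 + N      ≡⟨ +-assoc (inversions R x) 1 N ⟩
  inversions R x + suc N      ∎
  where open ≤-Reasoning

no-gain : ∀ {X Y Z N} → Y ≤ X → Z ≤ Y + N → Z ≢ X + suc N
no-gain {X} {N = N} Y≤X Z≤Y+N refl =
  <⇒≱ (+-monoʳ-< X (n<1+n N)) (≤-trans Z≤Y+N (+-monoˡ-≤ N Y≤X))

indicator-gain : ∀ u v {X Y Z N} → X + indicator u ≡ Y + indicator v → Z ≤ Y + N → Z ≡ X + suc N →
  u ≡ true × v ≡ false
indicator-gain true false _ _ _ = refl , refl
indicator-gain true true e le eq = ⊥-elim (no-gain (≤-reflexive (+-cancelʳ-≡ 1 _ _ (sym e))) le eq)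
indicator-gain false false e le eq = ⊥-elim (no-gain (≤-reflexive (+-cancelʳ-≡ 0 _ _ (sym e))) le eq)
indicator-gain false true {X} {Y} e le eq = ⊥-elim (no-gain Y≤X le eq)
  where
  Y≤X : Y ≤ X
  Y≤X = begin
    Y          ≤⟨ m≤m+n Y 1 ⟩
    Y + 1      ≡⟨ e ⟨
    X + 0      ≡⟨ +-identityʳ X ⟩
    X          ∎
    where open ≤-Reasoning

tightChain-swap : ∀ R p a b s {D N z} → Chain D N (p ++ b ∷ a ∷ s) z →
  inversions R z ≡ inversions R (p ++ a ∷ b ∷ s) + suc N →
  R a b ≡ true × R b a ≡ false
tightChain-swap R p a b s ch =
  indicator-gain (R a b) (R b a) (inversions-swap R p a b s) (inversions-chain-≤ R ch)

inversions-swap-↑ : ∀ R p a b s → R a b ≡ true → R b a ≡ false →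
  inversions R (p ++ b ∷ a ∷ s) ≡ inversions R (p ++ a ∷ b ∷ s) + 1
inversions-swap-↑ R p a b s ab ba = begin
  Y                           ≡⟨ +-identityʳ Y ⟨
  Y + indicator false         ≡⟨ cong ((Y +_) ∘ indicator) ba ⟨
  Y + indicator (R b a)       ≡⟨ inversions-swap R p a b s ⟨
  X + indicator (R a b)       ≡⟨ cong ((X +_) ∘ indicator) ab ⟩
  X + 1                       ∎
  where
  open ≡-Reasoning
  X Y : ℕ
  X = inversions R (p ++ a ∷ b ∷ s)
  Y = inversions R (p ++ b ∷ a ∷ s)

tight-tail : ∀ {X Y Z N} → Y ≡ X + 1 → Z ≡ X + suc N → Z ≡ Y + N
tight-tail {X} {N = N} refl refl = sym (+-assoc X 1 N)

tight-cons : ∀ {X Y Z M} → Y ≡ X + 1 → Z ≡ Y + M → Z ≡ X + suc M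
tight-cons {X} {M = M} refl refl = +-assoc X 1 M

-- Restriction of orders

restrict-++ : ∀ B p q → restrict B (p ++ q) ≡ restrict B p ++ restrict B q
restrict-++ B = filter-++ (_∈? B)

restrict-accept : ∀ B {c l l′} → c ∈ B → restrict B l ≡ l′ → restrict B (c ∷ l) ≡ c ∷ l′
restrict-accept B c∈B refl = filter-accept (_∈? B) c∈B

restrict-reject : ∀ B {c l l′} → c ∉ B → restrict B l ≡ l′ → restrict B (c ∷ l) ≡ l′
restrict-reject B c∉B refl = filter-reject (_∈? B) c∉B

restrict-reverse : ∀ B x → restrict B (reverse x) ≡ reverse (restrict B x)
restrict-reverse B [] = refl
restrict-reverse B (c ∷ x) = begin
  restrict B (reverse (c ∷ x))                 ≡⟨ cong (restrict B) (unfold-reverse c x) ⟩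
  restrict B (reverse x ++ [ c ])              ≡⟨ restrict-++ B (reverse x) [ c ] ⟩
  restrict B (reverse x) ++ restrict B [ c ]   ≡⟨ cong (_++ restrict B [ c ]) (restrict-reverse B x) ⟩
  reverse (restrict B x) ++ restrict B [ c ]   ≡⟨ snoc (c ∈? B) ⟩
  reverse (restrict B (c ∷ x))                 ∎
  where
  open ≡-Reasoning
  snoc : Dec (c ∈ B) → reverse (restrict B x) ++ restrict B [ c ] ≡ reverse (restrict B (c ∷ x))
  snoc (yes c∈B) = trans (cong (reverse (restrict B x) ++_) (restrict-accept B c∈B refl))
    (trans (sym (unfold-reverse c (restrict B x))) (cong reverse (sym (restrict-accept B c∈B refl))))
  snoc (no c∉B) = trans (cong (reverse (restrict B x) ++_) (restrict-reject B c∉B refl))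
    (trans (++-identityʳ _) (cong reverse (sym (restrict-reject B c∉B refl))))

restrict-swap₀ : ∀ B a b s → Dec (a ∈ B) → Dec (b ∈ B) →
  (restrict B (a ∷ b ∷ s) ≡ a ∷ b ∷ restrict B s × restrict B (b ∷ a ∷ s) ≡ b ∷ a ∷ restrict B s)
  ⊎ restrict B (a ∷ b ∷ s) ≡ restrict B (b ∷ a ∷ s)
restrict-swap₀ B a b s (yes a∈B) (yes b∈B) =
  inj₁ (restrict-accept B a∈B (restrict-accept B b∈B refl) , restrict-accept B b∈B (restrict-accept B a∈B refl))
restrict-swap₀ B a b s (yes a∈B) (no b∉B) =
  inj₂ (trans (restrict-accept B a∈B (restrict-reject B b∉B refl))
              (sym (restrict-reject B b∉B (restrict-accept B a∈B refl))))
restrict-swap₀ B a b s (no a∉B) (yes b∈B) =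
  inj₂ (trans (restrict-reject B a∉B (restrict-accept B b∈B refl))
              (sym (restrict-accept B b∈B (restrict-reject B a∉B refl))))
restrict-swap₀ B a b s (no a∉B) (no b∉B) =
  inj₂ (trans (restrict-reject B a∉B (restrict-reject B b∉B refl))
              (sym (restrict-reject B b∉B (restrict-reject B a∉B refl))))

restrict-swap : ∀ B p a b s →
  (∃[ p′ ] ∃[ s′ ] (restrict B (p ++ a ∷ b ∷ s) ≡ p′ ++ a ∷ b ∷ s′ ×
                    restrict B (p ++ b ∷ a ∷ s) ≡ p′ ++ b ∷ a ∷ s′))
  ⊎ restrict B (p ++ a ∷ b ∷ s) ≡ restrict B (p ++ b ∷ a ∷ s)
restrict-swap B p a b s with restrict-swap₀ B a b s (a ∈? B) (b ∈? B)
... | inj₁ (eab , eba) = inj₁ (restrict B p , restrict B s , prefix eab , prefix eba)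
  where
  prefix : ∀ {l l′} → restrict B l ≡ l′ → restrict B (p ++ l) ≡ restrict B p ++ l′
  prefix refl = restrict-++ B p _
... | inj₂ e = inj₂ (begin
  restrict B (p ++ a ∷ b ∷ s)                ≡⟨ restrict-++ B p (a ∷ b ∷ s) ⟩
  restrict B p ++ restrict B (a ∷ b ∷ s)     ≡⟨ cong (restrict B p ++_) e ⟩
  restrict B p ++ restrict B (b ∷ a ∷ s)     ≡⟨ restrict-++ B p (b ∷ a ∷ s) ⟨
  restrict B (p ++ b ∷ a ∷ s)                ∎)
  where open ≡-Reasoning

restrict-tightChain : ∀ R B {D N x z} → Chain D N x z → inversions R z ≡ inversions R x + N →
  ∃[ M ] (Chain (Restr D B) M (restrict B x) (restrict B z) ×
          inversions R (restrict B z) ≡ inversions R (restrict B x) + M)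
restrict-tightChain R B (done Dx) _ = 0 , done (_ , Dx , refl) , sym (+-identityʳ _)
restrict-tightChain R B (step Dx (p , a , b , s , refl , refl) ch) tight
  with ab , ba ← tightChain-swap R p a b s ch tight
  with M , ch′ , tight′ ← restrict-tightChain R B ch (tight-tail (inversions-swap-↑ R p a b s ab ba) tight)
  with restrict-swap B p a b s
... | inj₁ (p′ , s′ , ex , ey) =
  suc M , step (_ , Dx , refl) (p′ , a , b , s′ , ex , ey) ch′ , tight-cons up tight′
  where
  up : inversions R (restrict B (p ++ b ∷ a ∷ s)) ≡ inversions R (restrict B (p ++ a ∷ b ∷ s)) + 1
  up rewrite ex | ey = inversions-swap-↑ R p′ a b s′ ab ba
... | inj₂ e rewrite e = M , ch′ , tight′

-- Inversions with respect to the ranking of an order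

above-cons : ∀ {c d e} w → c ≢ d → c ≢ e → above (c ∷ w) d e ≡ above w d e
above-cons {c} {d} {e} w c≢d c≢e with c ≟ d
... | yes c≡d = ⊥-elim (c≢d c≡d)
... | no _ with c ≟ e
...   | yes c≡e = ⊥-elim (c≢e c≡e)
...   | no _ = refl

above-head : ∀ c w e → above (c ∷ w) c e ≡ does (e ∈? w)
above-head c w e with c ≟ c
... | yes _ = refl
... | no c≢c = ⊥-elim (c≢c refl)

above-head-below : ∀ {c d} w → c ≢ d → above (c ∷ w) d c ≡ false
above-head-below {c} {d} w c≢d with c ≟ d
... | yes c≡d = ⊥-elim (c≢d c≡d)
... | no _ with c ≟ c
...   | yes _ = refl
...   | no c≢c = ⊥-elim (c≢c refl)

above-restrict : ∀ B w {s t} → s ∈ B → t ∈ B → above (restrict B w) s t ≡ above w s t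
above-restrict B [] s∈B t∈B = refl
above-restrict B (c ∷ w) {s} {t} s∈B t∈B = by-cases (c ∈? B) (c ≟ s) (c ≟ t)
  where
  member : does (t ∈? restrict B w) ≡ does (t ∈? w)
  member with t ∈? restrict B w | t ∈? w
  ... | yes _ | yes _ = refl
  ... | no _ | no _ = refl
  ... | yes t∈ | no t∉ = ⊥-elim (t∉ (proj₁ (∈-filter⁻ (_∈? B) {xs = w} t∈)))
  ... | no t∉ | yes t∈ = ⊥-elim (t∉ (∈-filter⁺ (_∈? B) t∈ t∈B))
  by-cases : Dec (c ∈ B) → Dec (c ≡ s) → Dec (c ≡ t) → above (restrict B (c ∷ w)) s t ≡ above (c ∷ w) s t
  by-cases (yes c∈B) (yes refl) _ = begin
    above (restrict B (c ∷ w)) c t   ≡⟨ cong (λ l → above l c t) (restrict-accept B c∈B refl) ⟩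
    above (c ∷ restrict B w) c t     ≡⟨ above-head c (restrict B w) t ⟩
    does (t ∈? restrict B w)         ≡⟨ member ⟩
    does (t ∈? w)                    ≡⟨ above-head c w t ⟨
    above (c ∷ w) c t                ∎
    where open ≡-Reasoning
  by-cases (yes c∈B) (no c≢s) (yes refl) =
    trans (cong (λ l → above l s c) (restrict-accept B c∈B refl))
      (trans (above-head-below (restrict B w) c≢s) (sym (above-head-below w c≢s)))
  by-cases (yes c∈B) (no c≢s) (no c≢t) =
    trans (cong (λ l → above l s t) (restrict-accept B c∈B refl))
      (trans (above-cons (restrict B w) c≢s c≢t)
        (trans (above-restrict B w s∈B t∈B) (sym (above-cons w c≢s c≢t))))
  by-cases (no c∉B) _ _ =
    trans (cong (λ l → above l s t) (restrict-reject B c∉B refl))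
      (trans (above-restrict B w s∈B t∈B) (sym (above-cons w (outside s∈B) (outside t∈B))))
    where
    outside : ∀ {d} → d ∈ B → c ≢ d
    outside d∈B refl = c∉B d∈B

inversionsAfter-cong : ∀ R R′ c x → (∀ {d} → d ∈ x → R d c ≡ R′ d c) →
  inversionsAfter R c x ≡ inversionsAfter R′ c x
inversionsAfter-cong R R′ c [] _ = refl
inversionsAfter-cong R R′ c (d ∷ x) agree =
  cong₂ _+_ (cong indicator (agree (here refl))) (inversionsAfter-cong R R′ c x (agree ∘ there))

inversions-cong : ∀ R R′ x → (∀ {d e} → d ∈ x → e ∈ x → R d e ≡ R′ d e) →
  inversions R x ≡ inversions R′ x
inversions-cong R R′ [] _ = refl
inversions-cong R R′ (c ∷ x) agree = cong₂ _+_
  (inversionsAfter-cong R R′ c x (λ d∈x → agree (there d∈x) (here refl)))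
  (inversions-cong R R′ x (λ d∈x e∈x → agree (there d∈x) (there e∈x)))

inversions-restrict : ∀ B w x → x ⊆ B → inversions (above (restrict B w)) x ≡ inversions (above w) x
inversions-restrict B w x x⊆B =
  inversions-cong (above (restrict B w)) (above w) x (λ d∈x e∈x → above-restrict B w (x⊆B d∈x) (x⊆B e∈x))

inversionsAfter-none : ∀ R c x → (∀ {d} → d ∈ x → R d c ≡ false) → inversionsAfter R c x ≡ 0
inversionsAfter-none R c [] _ = refl
inversionsAfter-none R c (d ∷ x) none rewrite none (here refl) = inversionsAfter-none R c x (none ∘ there)

inversionsBefore-all : ∀ R c x → (∀ {d} → d ∈ x → R c d ≡ true) → inversionsBefore R c x ≡ length x
inversionsBefore-all R c [] _ = refl
inversionsBefore-all R c (d ∷ x) all rewrite all (here refl) = cong suc (inversionsBefore-all R c x (all ∘ there))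

inversionsAfter-snoc : ∀ R d x c → inversionsAfter R d (x ++ [ c ]) ≡ inversionsAfter R d x + indicator (R c d)
inversionsAfter-snoc R d [] c = +-identityʳ _
inversionsAfter-snoc R d (e ∷ x) c =
  trans (cong (indicator (R e d) +_) (inversionsAfter-snoc R d x c)) (sym (+-assoc (indicator (R e d)) _ _))

inversions-snoc : ∀ R x c → inversions R (x ++ [ c ]) ≡ inversions R x + inversionsBefore R c x
inversions-snoc R [] c = refl
inversions-snoc R (d ∷ x) c rewrite inversionsAfter-snoc R d x c | inversions-snoc R x c =
  rearrange (inversionsAfter R d x) (indicator (R c d)) (inversions R x) (inversionsBefore R c x)
  where
  rearrange : ∀ a b e f → a + b + (e + f) ≡ a + e + (b + f)
  rearrange = solve-∀

unique-head-≢ : ∀ {c d : ℕ} {w} → Unique (c ∷ w) → d ∈ w → c ≢ d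
unique-head-≢ (c≢w ∷ _) d∈w = All.lookup c≢w d∈w

inversions-self : ∀ w → Unique w → inversions (above w) w ≡ 0
inversions-self [] _ = refl
inversions-self (c ∷ w) u@(_ ∷ uw) = cong₂ _+_
  (inversionsAfter-none (above (c ∷ w)) c w (λ d∈w → above-head-below w (unique-head-≢ u d∈w)))
  (trans (inversions-cong (above (c ∷ w)) (above w) w
           (λ d∈w e∈w → above-cons w (unique-head-≢ u d∈w) (unique-head-≢ u e∈w)))
         (inversions-self w uw))

inversions-reverse : ∀ w → Unique w → inversions (above w) (reverse w) ≡ length w C 2
inversions-reverse [] _ = refl
inversions-reverse (c ∷ w) u@(_ ∷ uw) = begin
  inversions (above (c ∷ w)) (reverse (c ∷ w))
    ≡⟨ cong (inversions (above (c ∷ w))) (unfold-reverse c w) ⟩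
  inversions (above (c ∷ w)) (reverse w ++ [ c ])
    ≡⟨ inversions-snoc (above (c ∷ w)) (reverse w) c ⟩
  inversions (above (c ∷ w)) (reverse w) + inversionsBefore (above (c ∷ w)) c (reverse w)
    ≡⟨ cong₂ _+_ tail-inversions head-inversions ⟩
  inversions (above w) (reverse w) + length (reverse w)
    ≡⟨ cong₂ _+_ (inversions-reverse w uw) (trans (length-reverse w) (sym (nC1≡n (length w)))) ⟩
  length w C 2 + length w C 1
    ≡⟨ +-comm (length w C 2) _ ⟩
  length w C 1 + length w C 2
    ≡⟨ nCk+nC[k+1]≡[n+1]C[k+1] (length w) 1 ⟩
  length (c ∷ w) C 2 ∎
  where
  open ≡-Reasoning
  tail-inversions : inversions (above (c ∷ w)) (reverse w) ≡ inversions (above w) (reverse w)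
  tail-inversions = inversions-cong (above (c ∷ w)) (above w) (reverse w)
    (λ d∈ e∈ → above-cons w (unique-head-≢ u (reverse⁻ d∈)) (unique-head-≢ u (reverse⁻ e∈)))
  head-inversions : inversionsBefore (above (c ∷ w)) c (reverse w) ≡ length (reverse w)
  head-inversions = inversionsBefore-all (above (c ∷ w)) c (reverse w)
    (λ d∈ → trans (above-head c w _) (dec-true (_ ∈? w) (reverse⁻ d∈)))

-- Restricted domains

restrict-⊆ : ∀ B x → restrict B x ⊆ B
restrict-⊆ B x d∈ = proj₂ (∈-filter⁻ (_∈? B) {xs = x} d∈)

restrict-maximalChain : ∀ {D} w → Unique w → Chain D (length w C 2) w (reverse w) → ∀ B →
  Chain (Restr D B) (length (restrict B w) C 2) (restrict B w) (reverse (restrict B w))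
restrict-maximalChain {D} w uw ch B = restricted (restrict-tightChain (above w) B ch tight)
  where
  w′ : Order
  w′ = restrict B w
  uw′ : Unique w′
  uw′ = Unique.filter⁺ (_∈? B) uw
  tight : inversions (above w) (reverse w) ≡ inversions (above w) w + length w C 2
  tight = trans (inversions-reverse w uw) (cong (_+ length w C 2) (sym (inversions-self w uw)))
  restricted : ∃[ M ] (Chain (Restr D B) M w′ (restrict B (reverse w)) ×
                       inversions (above w) (restrict B (reverse w)) ≡ inversions (above w) w′ + M) →
    Chain (Restr D B) (length w′ C 2) w′ (reverse w′)
  restricted (M , ch′ , tight′) =
    subst₂ (λ n y → Chain (Restr D B) n w′ y) (sym length≡M) (restrict-reverse B w) ch′
    where
    open ≡-Reasoning
    length≡M : length w′ C 2 ≡ M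
    length≡M = begin
      length w′ C 2                                   ≡⟨ inversions-reverse w′ uw′ ⟨
      inversions (above w′) (reverse w′)
        ≡⟨ inversions-restrict B w (reverse w′) (restrict-⊆ B w ∘ reverse⁻) ⟩
      inversions (above w) (reverse w′)               ≡⟨ cong (inversions (above w)) (restrict-reverse B w) ⟨
      inversions (above w) (restrict B (reverse w))   ≡⟨ tight′ ⟩
      inversions (above w) w′ + M                     ≡⟨ cong (_+ M) (inversions-restrict B w w′ (restrict-⊆ B w)) ⟨
      inversions (above w′) w′ + M                    ≡⟨ cong (_+ M) (inversions-self w′ uw′) ⟩
      M                                               ∎

restrict-↭ : ∀ {B x} → Unique B → Unique x → B ⊆ x → restrict B x ↭ B
restrict-↭ {B} {x} uB ux B⊆x = ∼bag⇒↭ (unique∧set⇒bag (Unique.filter⁺ (_∈? B) ux) uB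
  (mk⇔ (restrict-⊆ B x) (λ d∈B → ∈-filter⁺ (_∈? B) (B⊆x d∈B) d∈B)))

restrict-semiConnected : ∀ {A D B} → Unique A → IsDomain A D → SemiConnected A D → Unique B → B ⊆ A →
  IsDomain B (Restr D B) × SemiConnected B (Restr D B)
restrict-semiConnected {A} {D} {B} uA domain (w , Dw , Drw , ch) uB B⊆A =
  restrictedDomain ,
  (restrict B w , (w , Dw , refl) , (reverse w , Drw , restrict-reverse B w) ,
   subst (λ n → Chain (Restr D B) (n C 2) (restrict B w) (reverse (restrict B w)))
     (↭-length (restrictedDomain _ (w , Dw , refl)))
     (restrict-maximalChain w (unique Dw) chain B))
  where
  unique : ∀ {x} → D x → Unique x
  unique {x} Dx = Unique-resp-↭ (↭-sym (domain x Dx)) uA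
  restrictedDomain : IsDomain B (Restr D B)
  restrictedDomain _ (x , Dx , refl) = restrict-↭ uB (unique Dx) (∈-resp-↭ (↭-sym (domain x Dx)) ∘ B⊆A)
  chain : Chain D (length w C 2) w (reverse w)
  chain = subst (λ n → Chain D (n C 2) w (reverse w)) (sym (↭-length (domain w Dw))) ch

-- Domains on three alternatives

length≡3 : ∀ (y : List ℕ) → length y ≡ 3 → ∃[ s ] ∃[ t ] ∃[ v ] (y ≡ s ∷ t ∷ v ∷ [])
length≡3 (s ∷ t ∷ v ∷ []) refl = s , t , v , refl

perms : ℕ → ℕ → ℕ → List Order
perms p q r =
  (p ∷ q ∷ r ∷ []) ∷ (p ∷ r ∷ q ∷ []) ∷ (q ∷ p ∷ r ∷ []) ∷
  (q ∷ r ∷ p ∷ []) ∷ (r ∷ p ∷ q ∷ []) ∷ (r ∷ q ∷ p ∷ []) ∷ []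

∈-perms : ∀ {p q r s t v} → Unique (s ∷ t ∷ v ∷ []) →
  s ∈ p ∷ q ∷ r ∷ [] → t ∈ p ∷ q ∷ r ∷ [] → v ∈ p ∷ q ∷ r ∷ [] →
  (s ∷ t ∷ v ∷ []) ∈ perms p q r
∈-perms _ (here refl) (there (here refl)) (there (there (here refl))) = here refl
∈-perms _ (here refl) (there (there (here refl))) (there (here refl)) = there (here refl)
∈-perms _ (there (here refl)) (here refl) (there (there (here refl))) = there (there (here refl))
∈-perms _ (there (here refl)) (there (there (here refl))) (here refl) = there (there (there (here refl)))
∈-perms _ (there (there (here refl))) (here refl) (there (here refl)) = there (there (there (there (here refl))))
∈-perms _ (there (there (here refl))) (there (here refl)) (here refl) = there (there (there (there (there (here refl)))))
∈-perms ((s≢t ∷ _) ∷ _) (here refl) (here refl) _ = ⊥-elim (s≢t refl)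
∈-perms ((s≢t ∷ _) ∷ _) (there (here refl)) (there (here refl)) _ = ⊥-elim (s≢t refl)
∈-perms ((s≢t ∷ _) ∷ _) (there (there (here refl))) (there (there (here refl))) _ = ⊥-elim (s≢t refl)
∈-perms ((_ ∷ s≢v ∷ _) ∷ _) (here refl) _ (here refl) = ⊥-elim (s≢v refl)
∈-perms ((_ ∷ s≢v ∷ _) ∷ _) (there (here refl)) _ (there (here refl)) = ⊥-elim (s≢v refl)
∈-perms ((_ ∷ s≢v ∷ _) ∷ _) (there (there (here refl))) _ (there (there (here refl))) = ⊥-elim (s≢v refl)
∈-perms (_ ∷ (t≢v ∷ _) ∷ _) _ (here refl) (here refl) = ⊥-elim (t≢v refl)
∈-perms (_ ∷ (t≢v ∷ _) ∷ _) _ (there (here refl)) (there (here refl)) = ⊥-elim (t≢v refl)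
∈-perms (_ ∷ (t≢v ∷ _) ∷ _) _ (there (there (here refl))) (there (there (here refl))) = ⊥-elim (t≢v refl)
∈-perms _ (there (there (there ()))) _ _
∈-perms _ _ (there (there (there ()))) _
∈-perms _ _ _ (there (there (there ())))

↭-perms : ∀ {p q r y} → Unique (p ∷ q ∷ r ∷ []) → y ↭ p ∷ q ∷ r ∷ [] → y ∈ perms p q r
↭-perms {y = y} u y↭pqr with length≡3 y (↭-length y↭pqr)
... | s , t , v , refl = ∈-perms (Unique-resp-↭ (↭-sym y↭pqr) u)
  (∈-resp-↭ y↭pqr (here refl)) (∈-resp-↭ y↭pqr (there (here refl))) (∈-resp-↭ y↭pqr (there (there (here refl))))

adjSwap₃ : ∀ {p q r y} → AdjSwap (p ∷ q ∷ r ∷ []) y → y ≡ q ∷ p ∷ r ∷ [] ⊎ y ≡ p ∷ r ∷ q ∷ []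
adjSwap₃ ([] , _ , _ , _ , refl , refl) = inj₁ refl
adjSwap₃ (_ ∷ [] , _ , _ , _ , refl , refl) = inj₂ refl
adjSwap₃ (_ ∷ _ ∷ [] , _ , _ , _ , () , _)
adjSwap₃ (_ ∷ _ ∷ _ ∷ [] , _ , _ , _ , () , _)
adjSwap₃ (_ ∷ _ ∷ _ ∷ _ ∷ _ , _ , _ , _ , () , _)

≢-head : ∀ {s s′ : ℕ} {l l′} → s ≢ s′ → s ∷ l ≢ s′ ∷ l′
≢-head s≢s′ e = s≢s′ (proj₁ (∷-injective e))

≢-second : ∀ {s s′ t t′ : ℕ} {l l′} → t ≢ t′ → s ∷ t ∷ l ≢ s′ ∷ t′ ∷ l′
≢-second t≢t′ e = ≢-head t≢t′ (proj₂ (∷-injective e))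

chain₃-middle : ∀ {E p q r} → Unique (p ∷ q ∷ r ∷ []) → Chain E 3 (p ∷ q ∷ r ∷ []) (r ∷ q ∷ p ∷ []) →
  (E (q ∷ p ∷ r ∷ []) × E (q ∷ r ∷ p ∷ [])) ⊎ (E (p ∷ r ∷ q ∷ []) × E (r ∷ p ∷ q ∷ []))
chain₃-middle ((_ ∷ p≢r ∷ []) ∷ (q≢r ∷ []) ∷ [] ∷ [])
              (step _ swap₁ (step E₁ swap₂ (step E₂ swap₃ (done _))))
  with adjSwap₃ swap₁
... | inj₁ refl with adjSwap₃ swap₂
...   | inj₂ refl = inj₁ (E₁ , E₂)
...   | inj₁ refl with adjSwap₃ swap₃
...     | inj₁ e = ⊥-elim (≢-head q≢r (sym e))
...     | inj₂ e = ⊥-elim (≢-head p≢r (sym e))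
chain₃-middle ((_ ∷ p≢r ∷ []) ∷ (q≢r ∷ []) ∷ [] ∷ [])
              (step _ swap₁ (step E₁ swap₂ (step E₂ swap₃ (done _))))
  | inj₂ refl with adjSwap₃ swap₂
...   | inj₁ refl = inj₂ (E₁ , E₂)
...   | inj₂ refl with adjSwap₃ swap₃
...     | inj₁ e = ⊥-elim (≢-head q≢r (sym e))
...     | inj₂ e = ⊥-elim (≢-head p≢r (sym e))

AtPos-1 : ∀ {s t v x} → AtPos (s ∷ t ∷ v ∷ []) x 1 → x ≡ s
AtPos-1 ([] , _ , refl , refl) = refl

AtPos-3 : ∀ {s t v x} → AtPos (s ∷ t ∷ v ∷ []) x 3 → x ≡ v
AtPos-3 (_ ∷ _ ∷ [] , _ , refl , refl) = refl

CycleFree : Pred → Set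
CycleFree E = ∀ {s t v} → Unique (s ∷ t ∷ v ∷ []) →
  E (s ∷ t ∷ v ∷ []) → E (t ∷ v ∷ s ∷ []) → ¬ E (v ∷ s ∷ t ∷ [])

exactlyFour : ∀ {E : Pred} {y₁ y₂ y₃ y₄} →
  Unique (y₁ ∷ y₂ ∷ y₃ ∷ y₄ ∷ []) → All E (y₁ ∷ y₂ ∷ y₃ ∷ y₄ ∷ []) →
  (∀ {y} → E y → y ∈ y₁ ∷ y₂ ∷ y₃ ∷ y₄ ∷ []) → ExactlyFour E
exactlyFour u all complete = _ , refl , u , λ _ → complete , All.lookup all

distinct₃ : ∀ {p q r : ℕ} → Unique (p ∷ q ∷ r ∷ []) → p ≢ q × q ≢ r × p ≢ r
distinct₃ ((p≢q ∷ p≢r ∷ []) ∷ (q≢r ∷ []) ∷ [] ∷ []) = p≢q , q≢r , p≢r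

module _ {E : Pred} {p q r : ℕ} (u : Unique (p ∷ q ∷ r ∷ [])) (perm : ∀ {y} → E y → y ↭ p ∷ q ∷ r ∷ [])
         (cycleFree : CycleFree E) (Epqr : E (p ∷ q ∷ r ∷ [])) (Erqp : E (r ∷ q ∷ p ∷ [])) where

  private
    p≢q : p ≢ q
    p≢q = proj₁ (distinct₃ u)
    q≢r : q ≢ r
    q≢r = proj₁ (proj₂ (distinct₃ u))
    p≢r : p ≢ r
    p≢r = proj₂ (proj₂ (distinct₃ u))
    excluded : ∀ {s t v} → E (s ∷ t ∷ v ∷ []) → E (t ∷ v ∷ s ∷ []) → ¬ E (v ∷ s ∷ t ∷ [])
    excluded Estv = cycleFree (Unique-resp-↭ (↭-sym (perm Estv)) u) Estv

  copious-neverLast : E (q ∷ p ∷ r ∷ []) → E (q ∷ r ∷ p ∷ []) →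
    ExactlyFour E × (∀ y → E y → ¬ AtPos y q 3)
  copious-neverLast Eqpr Eqrp =
    exactlyFour unique (Epqr ∷ Eqpr ∷ Eqrp ∷ Erqp ∷ []) classify , λ _ → never-last ∘ classify
    where
    L : List Order
    L = (p ∷ q ∷ r ∷ []) ∷ (q ∷ p ∷ r ∷ []) ∷ (q ∷ r ∷ p ∷ []) ∷ (r ∷ q ∷ p ∷ []) ∷ []
    unique : Unique L
    unique = (≢-head p≢q ∷ ≢-head p≢q ∷ ≢-head p≢r ∷ []) ∷ (≢-second p≢r ∷ ≢-head q≢r ∷ []) ∷
             (≢-head q≢r ∷ []) ∷ [] ∷ []
    by-perm : ∀ {y} → E y → y ∈ perms p q r → y ∈ L
    by-perm _ (here refl) = here refl
    by-perm Eprq (there (here refl)) = ⊥-elim (excluded Eprq Erqp Eqpr)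
    by-perm _ (there (there (here refl))) = there (here refl)
    by-perm _ (there (there (there (here refl)))) = there (there (here refl))
    by-perm Erpq (there (there (there (there (here refl))))) = ⊥-elim (excluded Erpq Epqr Eqrp)
    by-perm _ (there (there (there (there (there (here refl)))))) = there (there (there (here refl)))
    classify : ∀ {y} → E y → y ∈ L
    classify Ey = by-perm Ey (↭-perms u (perm Ey))
    never-last : ∀ {y} → y ∈ L → ¬ AtPos y q 3
    never-last (here refl) = q≢r ∘ AtPos-3
    never-last (there (here refl)) = q≢r ∘ AtPos-3
    never-last (there (there (here refl))) = p≢q ∘ sym ∘ AtPos-3
    never-last (there (there (there (here refl)))) = p≢q ∘ sym ∘ AtPos-3

  copious-neverFirst : E (p ∷ r ∷ q ∷ []) → E (r ∷ p ∷ q ∷ []) →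
    ExactlyFour E × (∀ y → E y → ¬ AtPos y q 1)
  copious-neverFirst Eprq Erpq =
    exactlyFour unique (Epqr ∷ Eprq ∷ Erpq ∷ Erqp ∷ []) classify , λ _ → never-first ∘ classify
    where
    L : List Order
    L = (p ∷ q ∷ r ∷ []) ∷ (p ∷ r ∷ q ∷ []) ∷ (r ∷ p ∷ q ∷ []) ∷ (r ∷ q ∷ p ∷ []) ∷ []
    unique : Unique L
    unique = (≢-second q≢r ∷ ≢-head p≢r ∷ ≢-head p≢r ∷ []) ∷ (≢-head p≢r ∷ ≢-head p≢r ∷ []) ∷
             (≢-second p≢q ∷ []) ∷ [] ∷ []
    by-perm : ∀ {y} → E y → y ∈ perms p q r → y ∈ L
    by-perm _ (here refl) = here refl
    by-perm _ (there (here refl)) = there (here refl)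
    by-perm Eqpr (there (there (here refl))) = ⊥-elim (excluded Eqpr Eprq Erqp)
    by-perm Eqrp (there (there (there (here refl)))) = ⊥-elim (excluded Eqrp Erpq Epqr)
    by-perm _ (there (there (there (there (here refl))))) = there (there (here refl))
    by-perm _ (there (there (there (there (there (here refl)))))) = there (there (there (here refl)))
    classify : ∀ {y} → E y → y ∈ L
    classify Ey = by-perm Ey (↭-perms u (perm Ey))
    never-first : ∀ {y} → y ∈ L → ¬ AtPos y q 1
    never-first (here refl) = p≢q ∘ sym ∘ AtPos-1
    never-first (there (here refl)) = p≢q ∘ sym ∘ AtPos-1
    never-first (there (there (here refl))) = q≢r ∘ AtPos-1
    never-first (there (there (there (here refl)))) = q≢r ∘ AtPos-1

  copiousTriple : Chain E 3 (p ∷ q ∷ r ∷ []) (r ∷ q ∷ p ∷ []) →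
    ExactlyFour E × ((∀ y → E y → ¬ AtPos y q 1) ⊎ (∀ y → E y → ¬ AtPos y q 3))
  copiousTriple ch with chain₃-middle u ch
  ... | inj₁ (Eqpr , Eqrp) = map₂ inj₂ (copious-neverLast Eqpr Eqrp)
  ... | inj₂ (Eprq , Erpq) = map₂ inj₁ (copious-neverFirst Eprq Erpq)

record Ranked (x : Order) (s t v : ℕ) : Set where
  field
    st : above x s t ≡ true
    ts : above x t s ≡ false
    sv : above x s v ≡ true
    vs : above x v s ≡ false
    tv : above x t v ≡ true
    vt : above x v t ≡ false

ranked-triple : ∀ {s t v} → Unique (s ∷ t ∷ v ∷ []) → Ranked (s ∷ t ∷ v ∷ []) s t v
ranked-triple {s} {t} {v} ((s≢t ∷ s≢v ∷ []) ∷ (t≢v ∷ []) ∷ [] ∷ []) = record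
  { st = trans (above-head s (t ∷ v ∷ []) t) (dec-true (t ∈? t ∷ v ∷ []) (here refl))
  ; ts = above-head-below (t ∷ v ∷ []) s≢t
  ; sv = trans (above-head s (t ∷ v ∷ []) v) (dec-true (v ∈? t ∷ v ∷ []) (there (here refl)))
  ; vs = above-head-below (t ∷ v ∷ []) s≢v
  ; tv = trans (above-cons (t ∷ v ∷ []) s≢t s≢v)
           (trans (above-head t (v ∷ []) v) (dec-true (v ∈? v ∷ []) (here refl)))
  ; vt = trans (above-cons (t ∷ v ∷ []) s≢v s≢t) (above-head-below (v ∷ []) t≢v)
  }

ranked : ∀ B x {s t v} → Unique (s ∷ t ∷ v ∷ []) → restrict B x ≡ s ∷ t ∷ v ∷ [] → Ranked x s t v
ranked B x {s} {t} {v} u e = record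
  { st = via first second st ; ts = via second first ts
  ; sv = via first third sv ; vs = via third first vs
  ; tv = via second third tv ; vt = via third second vt
  }
  where
  open Ranked (ranked-triple u)
  first : s ∈ s ∷ t ∷ v ∷ []
  first = here refl
  second : t ∈ s ∷ t ∷ v ∷ []
  second = there (here refl)
  third : v ∈ s ∷ t ∷ v ∷ []
  third = there (there (here refl))
  in-B : ∀ {i} → i ∈ s ∷ t ∷ v ∷ [] → i ∈ B
  in-B i∈ = restrict-⊆ B x (subst (_ ∈_) (sym e) i∈)
  via : ∀ {i j o} → i ∈ s ∷ t ∷ v ∷ [] → j ∈ s ∷ t ∷ v ∷ [] →
    above (s ∷ t ∷ v ∷ []) i j ≡ o → above x i j ≡ o
  via {i} {j} i∈ j∈ ranks =
    trans (sym (above-restrict B x (in-B i∈) (in-B j∈))) (trans (cong (λ l → above l i j) e) ranks)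

condorcet⇒cycleFree : ∀ {D} → Condorcet D → ∀ B → CycleFree (Restr D B)
condorcet⇒cycleFree condorcet B {s} {t} {v} u@((s≢t ∷ s≢v ∷ []) ∷ (t≢v ∷ []) ∷ [] ∷ [])
  (x₁ , D₁ , e₁) (x₂ , D₂ , e₂) (x₃ , D₃ , e₃) =
  <-asym (s≤s (s≤s z≤n)) (subst₂ _<_ (count₃ v s X₁.vs X₂.tv X₃.st) (count₃ s v X₁.sv X₂.vt X₃.ts) s>v)
  where
  module X₁ = Ranked (ranked B x₁ u e₁)
  module X₂ = Ranked (ranked B x₂ ((t≢v ∷ (s≢t ∘ sym) ∷ []) ∷ ((s≢v ∘ sym) ∷ []) ∷ [] ∷ []) e₂)
  module X₃ = Ranked (ranked B x₃ (((s≢v ∘ sym) ∷ (t≢v ∘ sym) ∷ []) ∷ (s≢t ∷ []) ∷ [] ∷ []) e₃)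
  P : List Order
  P = x₁ ∷ x₂ ∷ x₃ ∷ []
  count₃ : ∀ a b {u₁ u₂ u₃} → above x₁ a b ≡ u₁ → above x₂ a b ≡ u₂ → above x₃ a b ≡ u₃ →
    count P a b ≡ indicator u₁ + (indicator u₂ + (indicator u₃ + 0))
  count₃ a b refl refl refl = refl
  s>t : Maj P s t
  s>t = subst₂ _<_ (sym (count₃ t s X₁.ts X₂.sv X₃.vt)) (sym (count₃ s t X₁.st X₂.vs X₃.tv))
               (s≤s (s≤s z≤n))
  t>v : Maj P t v
  t>v = subst₂ _<_ (sym (count₃ v t X₁.vt X₂.ts X₃.sv)) (sym (count₃ t v X₁.tv X₂.st X₃.vs))
               (s≤s (s≤s z≤n))
  s>v : Maj P s v
  s>v = condorcet P (D₁ ∷ D₂ ∷ D₃ ∷ []) (1 , refl) s t v s>t t>v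

threeAlternatives : ∀ {B E} → Unique B → length B ≡ 3 → IsDomain B E → SemiConnected B E → CycleFree E →
  ExactlyFour E × ∃[ q ] (q ∈ B × ((∀ y → E y → ¬ AtPos y q 1) ⊎ (∀ y → E y → ¬ AtPos y q 3)))
threeAlternatives {B} {E} uB |B|≡3 domain (w , Ew , Erw , ch) cycleFree
  with length≡3 w (trans (↭-length (domain w Ew)) |B|≡3)
... | p , q , r , refl =
  proj₁ triple , q , ∈-resp-↭ (domain _ Ew) (there (here refl)) , proj₂ triple
  where
  triple : ExactlyFour E × ((∀ y → E y → ¬ AtPos y q 1) ⊎ (∀ y → E y → ¬ AtPos y q 3))
  triple = copiousTriple (Unique-resp-↭ (↭-sym (domain _ Ew)) uB)
    (λ {y} Ey → ↭-trans (domain y Ey) (↭-sym (domain _ Ew))) cycleFree Ew Erw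
    (subst (λ n → Chain E (n C 2) (p ∷ q ∷ r ∷ []) (r ∷ q ∷ p ∷ [])) |B|≡3 ch)

remove-semiConnected : ∀ {A D} a → Unique A → IsDomain A D → SemiConnected A D →
  IsDomain (remove a A) (Restr D (remove a A)) ×
  SemiConnected (remove a A) (Restr D (remove a A)) ×
  MaximalWidth (Restr D (remove a A))
remove-semiConnected {A} a uA domain semiConnected
  with domain′ , semiConnected′@(w , Ew , Erw , _) ← restrict-semiConnected uA domain semiConnected
    (Unique.filter⁺ (λ c → ¬? (c ≟ a)) uA) (proj₁ ∘ ∈-filter⁻ (λ c → ¬? (c ≟ a)) {xs = A})
  = domain′ , semiConnected′ , w , Ew , Erw

distinctTriple-unique : ∀ {A a b c} → DistinctTriple A a b c → Unique (a ∷ b ∷ c ∷ [])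
distinctTriple-unique (_ , _ , _ , a≢b , b≢c , a≢c) = (a≢b ∷ a≢c ∷ []) ∷ (b≢c ∷ []) ∷ [] ∷ []

distinctTriple-⊆ : ∀ {A a b c} → DistinctTriple A a b c → (a ∷ b ∷ c ∷ []) ⊆ A
distinctTriple-⊆ (a∈A , _ , _) (here refl) = a∈A
distinctTriple-⊆ (_ , b∈A , _) (there (here refl)) = b∈A
distinctTriple-⊆ (_ , _ , c∈A , _) (there (there (here refl))) = c∈A

restrict-triple : ∀ {A D a b c} → Unique A → IsDomain A D → Condorcet D → SemiConnected A D →
  DistinctTriple A a b c →
  ExactlyFour (Restr D (a ∷ b ∷ c ∷ [])) ×
  ∃[ x ] ((x ≡ a ⊎ x ≡ b ⊎ x ≡ c) × (Never D a b c x 1 ⊎ Never D a b c x 3))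
restrict-triple {A} {D} {a} {b} {c} uA domain condorcet semiConnected abc
  with domainB , semiConnectedB ←
         restrict-semiConnected uA domain semiConnected (distinctTriple-unique abc) (distinctTriple-⊆ abc)
  with four , q , q∈B , never ← threeAlternatives (distinctTriple-unique abc) refl domainB semiConnectedB
    (condorcet⇒cycleFree condorcet (a ∷ b ∷ c ∷ []))
  = four , q , which q∈B , Sum.map restrictedNever restrictedNever never
  where
  B : List ℕ
  B = a ∷ b ∷ c ∷ []
  which : ∀ {x} → x ∈ B → x ≡ a ⊎ x ≡ b ⊎ x ≡ c
  which (here e) = inj₁ e
  which (there (here e)) = inj₂ (inj₁ e)
  which (there (there (here e))) = inj₂ (inj₂ e)
  restrictedNever : ∀ {x i} → (∀ y → Restr D B y → ¬ AtPos y x i) → Never D a b c x i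
  restrictedNever never v Dv = never _ (v , Dv , refl)

proposition2 : (A : List ℕ) → Unique A → (D : Pred) → IsDomain A D →
    Condorcet D → MaximalWidth D → SemiConnected A D →
    ((a : ℕ) → a ∈ A →
      IsDomain (remove a A) (Restr D (remove a A)) ×
      SemiConnected (remove a A) (Restr D (remove a A)) ×
      MaximalWidth (Restr D (remove a A)))
    × (Copious A D × PeakPit A D)
proposition2 A uA D domain condorcet _ semiConnected =
  (λ a _ → remove-semiConnected a uA domain semiConnected) ,
  (condorcet , λ _ _ _ abc → proj₁ (restrict-triple uA domain condorcet semiConnected abc)) ,
  (λ _ _ _ abc → proj₂ (restrict-triple uA domain condorcet semiConnected abc))
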